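{- Let $M_1=(S,\mathcal{I}_1)$, $M_2=(S,\mathcal{I}_2)$ be matroids with weights $W:S\to\mathbb{Z}$ such that $W$ isolates a size-$k$ common independent set $I_k$ of $M_1$ and $M_2$. Then the exchange graph $\mathcal{E}_{M_1,M_2,I_k}$ contains no cycle of weight $0$.
   Context: $W(I)=\sum_{s\in I}W(s)$. $W$ isolates a size-$k$ common independent set $I_k$ if $I_k\in\mathcal{I}_1\cap\mathcal{I}_2$, $|I_k|=k$, and every other size-$k$ set in $\mathcal{I}_1\cap\mathcal{I}_2$ has strictly larger weight. Exchange graph $\mathcal{E}_{M_1,M_2,I}$: directed graph on $S$ where for $x\notin I$, $y\in I$: $(y,x)$ is an edge iff $I\setminus\{y\}\cup\{x\}\in\mathcal{I}_1$, and $(x,y)$ is an edge iff $I\setminus\{y\}\cup\{x\}\in\mathcal{I}_2$; vertex weights $l(s)=W(s)$ for $s\notin I$, $l(s)=-W(s)$ for $s\in I$. The weight of a cycle is the sum of $l$ over its vertices. -}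

module Defs where

open import Data.Nat using (ℕ; suc)
open import Data.Fin using (Fin)
open import Data.Fin.Subset using (Subset; _∈_; _∉_; _⊆_; ⊥; ∣_∣; _∪_; ⁅_⁆; _─_; _-_)
open import Data.Integer using (ℤ; _+_; -_; 0ℤ)
open import Data.List using (List; []; _∷_; map; foldr; filter)
open import Data.List.Base using (allFin)
import Data.Nat
import Data.Empty
open import Relation.Nullary using (yes; no)
open import Data.Fin.Subset.Properties using (_∈?_)
open import Data.List.Relation.Unary.Unique.Propositional using (Unique)
open import Data.Product using (_×_; Σ; ∃)
open import Relation.Binary.PropositionalEquality using (_≡_; _≢_)
open import Data.Integer using (_<_)

record Matroid (n : ℕ) : Set₁ where
  field
    Indep      : Subset n → Set
    empty-ind  : Indep ⊥
    hereditary : ∀ {A B} → A ⊆ B → Indep B → Indep A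
    augment    : ∀ {A B} → Indep A → Indep B → ∣ A ∣ Data.Nat.< ∣ B ∣ →
                 ∃ λ x → x ∈ B × x ∉ A × Indep (A ∪ ⁅ x ⁆)
open Matroid public

sumℤ : List ℤ → ℤ
sumℤ = foldr _+_ 0ℤ

weightOf : ∀ {n} → (Fin n → ℤ) → Subset n → ℤ
weightOf {n} W I = sumℤ (map W (filter (_∈? I) (allFin n)))

CommonIndep : ∀ {n} → Matroid n → Matroid n → Subset n → Set
CommonIndep M₁ M₂ I = Indep M₁ I × Indep M₂ I

Isolates : ∀ {n} → Matroid n → Matroid n → (Fin n → ℤ) → ℕ → Subset n → Set
Isolates M₁ M₂ W k Iₖ =
  CommonIndep M₁ M₂ Iₖ × ∣ Iₖ ∣ ≡ k ×
  (∀ J → CommonIndep M₁ M₂ J → ∣ J ∣ ≡ k → J ≢ Iₖ → weightOf W Iₖ < weightOf W J)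

swap : ∀ {n} → Subset n → Fin n → Fin n → Subset n
swap I y x = (I - y) ∪ ⁅ x ⁆

data Edge {n} (M₁ M₂ : Matroid n) (I : Subset n) : Fin n → Fin n → Set where
  edge₁ : ∀ {x y} → x ∉ I → y ∈ I → Indep M₁ (swap I y x) → Edge M₁ M₂ I y x
  edge₂ : ∀ {x y} → x ∉ I → y ∈ I → Indep M₂ (swap I y x) → Edge M₁ M₂ I x y

Chain : ∀ {n} (M₁ M₂ : Matroid n) (I : Subset n) → Fin n → List (Fin n) → Fin n → Set
Chain M₁ M₂ I a []       b = Edge M₁ M₂ I a b
Chain M₁ M₂ I a (c ∷ cs) b = Edge M₁ M₂ I a c × Chain M₁ M₂ I c cs b

-- A (simple directed) cycle with vertex list v ∷ vs: distinct vertices,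
-- consecutive edges, and a closing edge from the last vertex back to v.
IsCycle : ∀ {n} (M₁ M₂ : Matroid n) (I : Subset n) → List (Fin n) → Set
IsCycle M₁ M₂ I []       = Data.Empty.⊥
IsCycle M₁ M₂ I (v ∷ vs) = Unique (v ∷ vs) × Chain M₁ M₂ I v vs v

l : ∀ {n} → (Fin n → ℤ) → Subset n → Fin n → ℤ
l W I s with s ∈? I
... | yes _ = - W s
... | no  _ = W s

cycleWeight : ∀ {n} → (Fin n → ℤ) → Subset n → List (Fin n) → ℤ
cycleWeight W I vs = sumℤ (map (l W I) vs)

-- Suppose some cycle of the exchange graph has weight ≤ 0, and let C be a shortest one, rotated
-- so that it starts in Iₖ. Weighting each vertex of C by the l-weight of the part of C before
-- it gives a potential: a chord u → w between vertices of C closes a shorter, hence positive,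
-- cycle, so w lies strictly below the successor of u. Cut C into its consecutive pairs (y , x)
-- and order them by this potential; then no y can be exchanged against the x of a later pair,
-- and performing the exchanges one at a time (Krogdahl's argument) shows that Iₖ Δ C is
-- independent in M₁. Reversing C exchanges the roles of M₁ and M₂. Since C alternates between
-- Iₖ and its complement, Iₖ Δ C has size k, and its weight W(Iₖ) + l(C) ≤ W(Iₖ) contradicts
-- the isolation. Hence every cycle has positive weight.
module Submission where

open import Defs
open import Data.Bool using (not)
open import Data.Empty using (⊥-elim)
open import Data.Fin using (Fin; zero; suc)
open import Data.Fin.Properties using (_≟_)
open import Data.Fin.Subset using (Subset; inside; outside; _∈_; _∉_; _⊆_; _∪_; ⁅_⁆; _─_; _-_; ∣_∣)
open import Data.Fin.Subset.Properties
  using ( _∈?_; drop-there; ∪-identityʳ; x∈⁅x⁆; x∈⁅y⁆⇒x≡y; x∈p∪q⁻; x∈p∪q⁺; p⊆p∪q; p─q⊆p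
        ; x∈p∧x≢y⇒x∈p-y; x∈p⇒∣p-x∣<∣p∣; p─x─y≡p─y─x)
open import Data.Integer as ℤ using (ℤ; +_; 0ℤ; _+_; -_)
import Data.Integer.Properties as ℤP
open import Data.Integer.Tactic.RingSolver using (solve-∀)
open import Data.List
  using (List; []; _∷_; _++_; [_]; length; map; foldr; filter; reverse; allFin; tabulate)
open import Data.List.Properties
  using (map-∘; map-++; map-tabulate; ++-assoc; ++-identityʳ; unfold-reverse)
open import Data.List.Membership.Propositional using () renaming (_∈_ to _∈ₗ_; _∉_ to _∉ₗ_)
open import Data.List.Membership.Propositional.Properties using (∈-++⁺ˡ; ∈-++⁺ʳ; ∈-++⁻; ∈-∃++)
open import Data.List.Relation.Unary.All as All using (All; []; _∷_)
open import Data.List.Relation.Unary.Any using (Any; here; there)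
open import Data.List.Relation.Unary.AllPairs as AllPairs using (AllPairs; []; _∷_)
import Data.List.Relation.Unary.AllPairs.Properties as AllPairsₚ
open import Data.List.Relation.Unary.Unique.Propositional using (Unique)
open import Data.List.Relation.Unary.Unique.Propositional.Properties using (Unique[x∷xs]⇒x∉xs)
open import Data.List.Relation.Binary.Permutation.Propositional as ↭ using (_↭_; ↭-sym; ↭-prep; ↭⇒↭ₛ)
open import Data.List.Relation.Binary.Permutation.Propositional.Properties
  using (All-resp-↭; Any-resp-↭; ∈-resp-↭; ++-comm; shift; ↭-reverse; ↭-length)
  renaming (map⁺ to ↭-map⁺)
import Data.List.Relation.Binary.Permutation.Setoid.Properties as ↭ₛ
import Data.List.Relation.Unary.Sorted.TotalOrder.Properties as Sorted
import Data.List.Sort as Sort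
open import Data.Nat as ℕ using (ℕ; suc; s≤s; z≤n)
import Data.Nat.Properties as ℕP
open import Data.Product using (_×_; _,_; proj₁; proj₂; map₁; ∃; ∃₂)
open import Data.Sum using (_⊎_; inj₁; inj₂; [_,_]′)
open import Data.Vec using ([]; _∷_; _[_]%=_; here; there)
open import Data.Vec.Properties using (updateAt-commutes; updateAt-minimal)
open import Function using (_∘_; _on_)
open import Relation.Binary.Bundles using (DecTotalOrder)
import Relation.Binary.Construct.On as On
open import Relation.Binary.PropositionalEquality
  using (_≡_; _≢_; refl; sym; trans; cong; cong₂; subst; module ≡-Reasoning)
  renaming (setoid to ≡-setoid)
open import Relation.Nullary using (¬_; Dec; yes; no)

module _ {A : Set} where

  Unique-resp-↭ : ∀ {xs ys : List A} → xs ↭ ys → Unique xs → Unique ys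
  Unique-resp-↭ p = ↭ₛ.Unique-resp-↭ (≡-setoid A) (↭⇒↭ₛ p)

  Unique-++⁻ˡ : ∀ (xs : List A) {ys} → Unique (xs ++ ys) → Unique xs
  Unique-++⁻ˡ []       _        = []
  Unique-++⁻ˡ (x ∷ xs) (x∉ ∷ u) = All.tabulate (All.lookup x∉ ∘ ∈-++⁺ˡ) ∷ Unique-++⁻ˡ xs u

  Unique⇒∉-prefix : ∀ (xs : List A) {w ys} → Unique (xs ++ w ∷ ys) → w ∉ₗ xs
  Unique⇒∉-prefix xs {w} {ys} u = Unique[x∷xs]⇒x∉xs (Unique-resp-↭ (shift w xs ys) u) ∘ ∈-++⁺ˡ

  AllPairs-mapWith : ∀ {P : A → Set} {R S : A → A → Set} →
                     (∀ {x y} → P x → P y → R x y → S x y) →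
                     ∀ {xs} → All P xs → AllPairs R xs → AllPairs S xs
  AllPairs-mapWith f []         []         = []
  AllPairs-mapWith f (px ∷ pxs) (rx ∷ rxs) =
    All.zipWith (λ (py , r) → f px py r) (pxs , rx) ∷ AllPairs-mapWith f pxs rxs

  length-++-∷ʳ< : ∀ (xs : List A) {u t ys} → length (xs ++ [ u ]) ℕ.< length (xs ++ u ∷ t ∷ ys)
  length-++-∷ʳ< []       = s≤s (s≤s z≤n)
  length-++-∷ʳ< (_ ∷ xs) = s≤s (length-++-∷ʳ< xs)

module _ {A : Set} (G : A → ℤ) where

  private
    order = On.decTotalOrder ℤP.≤-decTotalOrder G
    module ByG = Sort order

  sortBy : List A → List A
  sortBy = ByG.sort

  sortBy-↭ : ∀ xs → sortBy xs ↭ xs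
  sortBy-↭ = ByG.sort-↭

  sortBy-sorted : ∀ xs → AllPairs (λ p q → G p ℤ.≤ G q) (sortBy xs)
  sortBy-sorted xs = Sorted.Sorted⇒AllPairs (DecTotalOrder.totalOrder order) (ByG.sort-↗ xs)

module _ {A : Set} where

  unpairs : List (A × A) → List A
  unpairs []             = []
  unpairs ((a , b) ∷ ps) = a ∷ b ∷ unpairs ps

  unpairs-split : ∀ {ps p} → p ∈ₗ ps → ∃₂ λ R N → unpairs ps ≡ R ++ proj₁ p ∷ proj₂ p ∷ N
  unpairs-split {(a , b) ∷ ps} (here refl)  = [] , unpairs ps , refl
  unpairs-split {(a , b) ∷ ps} (there p∈ps) with unpairs-split p∈ps
  ... | R , N , eq = a ∷ b ∷ R , N , cong (λ K → a ∷ b ∷ K) eq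

  ∈-unpairs : ∀ {ps p} → p ∈ₗ ps → proj₁ p ∈ₗ unpairs ps × proj₂ p ∈ₗ unpairs ps
  ∈-unpairs p∈ps with unpairs-split p∈ps
  ... | R , N , eq rewrite eq = ∈-++⁺ʳ R (here refl) , ∈-++⁺ʳ R (there (here refl))

  unpairs-cover : ∀ {P : A → Set} {ps w} → All (P ∘ proj₁) ps → w ∈ₗ unpairs ps → ¬ P w →
                  Any (λ p → w ≡ proj₂ p) ps
  unpairs-cover {ps = _ ∷ _} (Pa ∷ _)  (here refl)         ¬Pw = ⊥-elim (¬Pw Pa)
  unpairs-cover {ps = _ ∷ _} _         (there (here refl)) _   = here refl
  unpairs-cover {ps = _ ∷ _} (_ ∷ Pps) (there (there w∈))  ¬Pw = there (unpairs-cover Pps w∈ ¬Pw)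

  unpairs-proj₂-distinct : ∀ {ps} → Unique (unpairs ps) → AllPairs (_≢_ on proj₂) ps
  unpairs-proj₂-distinct {[]}           _            = []
  unpairs-proj₂-distinct {(a , b) ∷ ps} (_ ∷ b∉ ∷ u) =
    All.tabulate (All.lookup b∉ ∘ proj₂ ∘ ∈-unpairs) ∷ unpairs-proj₂-distinct u

sumℤ-resp-↭ : ∀ {xs ys : List ℤ} → xs ↭ ys → sumℤ xs ≡ sumℤ ys
sumℤ-resp-↭ p = ↭ₛ.foldr-commMonoid (≡-setoid ℤ) ℤP.+-0-isCommutativeMonoid (↭⇒↭ₛ p)

sumℤ-++ : ∀ xs ys → sumℤ (xs ++ ys) ≡ sumℤ xs + sumℤ ys
sumℤ-++ []       ys = sym (ℤP.+-identityˡ (sumℤ ys))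
sumℤ-++ (x ∷ xs) ys =
  trans (cong (λ s → x + s) (sumℤ-++ xs ys)) (sym (ℤP.+-assoc x (sumℤ xs) (sumℤ ys)))

i<i+j : ∀ {i j} → 0ℤ ℤ.< j → i ℤ.< i + j
i<i+j {i} {j} 0<j = subst (ℤ._< i + j) (ℤP.+-identityʳ i) (ℤP.+-monoʳ-< i 0<j)

i+j<i : ∀ {i j} → j ℤ.< 0ℤ → i + j ℤ.< i
i+j<i {i} {j} j<0 = subst (i + j ℤ.<_) (ℤP.+-identityʳ i) (ℤP.+-monoʳ-< i j<0)

0<i∧i+j≤0⇒j<0 : ∀ {i j} → 0ℤ ℤ.< i → i + j ℤ.≤ 0ℤ → j ℤ.< 0ℤ
0<i∧i+j≤0⇒j<0 {i} {j} 0<i i+j≤0 = begin-strict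
  j              ≡⟨ cancel i j ⟩
  i + j + - i    ≤⟨ ℤP.+-monoˡ-≤ (- i) i+j≤0 ⟩
  0ℤ + - i       ≡⟨ ℤP.+-identityˡ (- i) ⟩
  - i            <⟨ ℤP.neg-mono-< 0<i ⟩
  0ℤ             ∎
  where
  open ℤP.≤-Reasoning
  cancel : ∀ i j → j ≡ i + j + - i
  cancel = solve-∀

-- Subsets, single exchanges and symmetric differences

x∈p─q⇒x∉q : ∀ {n} {x : Fin n} (p q : Subset n) → x ∈ p ─ q → x ∉ q
x∈p─q⇒x∉q (inside ∷ p) (outside ∷ q) here       ()
x∈p─q⇒x∉q (_ ∷ p)      (_ ∷ q)       (there x∈) (there x∈q) = x∈p─q⇒x∉q p q x∈ x∈q

x∈p-y⇒x≢y : ∀ {n} {p : Subset n} {x y} → x ∈ p - y → x ≢ y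
x∈p-y⇒x≢y {p = p} {x} x∈ refl = x∈p─q⇒x∉q p ⁅ x ⁆ x∈ (x∈⁅x⁆ x)

x∉p⇒∣p∪⁅x⁆∣≡1+∣p∣ : ∀ {n} {x : Fin n} (p : Subset n) → x ∉ p → ∣ p ∪ ⁅ x ⁆ ∣ ≡ suc ∣ p ∣
x∉p⇒∣p∪⁅x⁆∣≡1+∣p∣ {x = zero}  (inside ∷ p)  x∉ = ⊥-elim (x∉ here)
x∉p⇒∣p∪⁅x⁆∣≡1+∣p∣ {x = zero}  (outside ∷ p) _  = cong (suc ∘ ∣_∣) (∪-identityʳ p)
x∉p⇒∣p∪⁅x⁆∣≡1+∣p∣ {x = suc x} (inside ∷ p)  x∉ = cong suc (x∉p⇒∣p∪⁅x⁆∣≡1+∣p∣ p (x∉ ∘ there))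
x∉p⇒∣p∪⁅x⁆∣≡1+∣p∣ {x = suc x} (outside ∷ p) x∉ = x∉p⇒∣p∪⁅x⁆∣≡1+∣p∣ p (x∉ ∘ there)

module _ {n : ℕ} where

  ∈-swap⁻ : ∀ {p : Subset n} {w y x} → w ∈ swap p y x → (w ∈ p × w ≢ y) ⊎ w ≡ x
  ∈-swap⁻ {p} {y = y} {x} w∈ with x∈p∪q⁻ (p - y) ⁅ x ⁆ w∈
  ... | inj₁ w∈p-y = inj₁ (p─q⊆p p ⁅ y ⁆ w∈p-y , x∈p-y⇒x≢y w∈p-y)
  ... | inj₂ w∈⁅x⁆ = inj₂ (x∈⁅y⁆⇒x≡y x w∈⁅x⁆)

  swap-kept : ∀ {p : Subset n} {w y x} → w ∈ p → w ≢ y → w ∈ swap p y x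
  swap-kept w∈p w≢y = x∈p∪q⁺ (inj₁ (x∈p∧x≢y⇒x∈p-y w∈p w≢y))

  swap-new : ∀ {p : Subset n} {y x} → x ∈ swap p y x
  swap-new {x = x} = x∈p∪q⁺ (inj₂ (x∈⁅x⁆ x))

  ∣swap∣≤∣p∣ : ∀ {p : Subset n} {y x} → y ∈ p → x ∉ p → ∣ swap p y x ∣ ℕ.≤ ∣ p ∣
  ∣swap∣≤∣p∣ {p} {y} y∈p x∉p = ℕP.≤-trans
    (ℕP.≤-reflexive (x∉p⇒∣p∪⁅x⁆∣≡1+∣p∣ (p - y) (x∉p ∘ p─q⊆p p ⁅ y ⁆)))
    (x∈p⇒∣p-x∣<∣p∣ y∈p)

  swap-mono : ∀ {p q : Subset n} {y x} → p ⊆ q → swap p y x ⊆ swap q y x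
  swap-mono p⊆q w∈ with ∈-swap⁻ w∈
  ... | inj₁ (w∈p , w≢y) = swap-kept (p⊆q w∈p) w≢y
  ... | inj₂ refl        = swap-new

  swap⊆swap-∪⁅⁆ : ∀ {p : Subset n} {a x} b → swap p a x ⊆ swap (p - a) b x ∪ ⁅ b ⁆
  swap⊆swap-∪⁅⁆ b {w} w∈ with ∈-swap⁻ w∈
  ... | inj₂ refl = x∈p∪q⁺ (inj₁ swap-new)
  ... | inj₁ (w∈p , w≢a) with w ≟ b
  ...   | yes refl = x∈p∪q⁺ (inj₂ (x∈⁅x⁆ w))
  ...   | no w≢b   = x∈p∪q⁺ (inj₁ (swap-kept (x∈p∧x≢y⇒x∈p-y w∈p w≢a) w≢b))

  swap²⊆swap-∪⁅⁆ : ∀ {p : Subset n} {a x′ b x} → swap (swap p a x′) b x ⊆ swap (p - a) b x ∪ ⁅ x′ ⁆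
  swap²⊆swap-∪⁅⁆ {x′ = x′} w∈ with ∈-swap⁻ w∈
  ... | inj₂ refl = x∈p∪q⁺ (inj₁ swap-new)
  ... | inj₁ (w∈swap , w≢b) with ∈-swap⁻ w∈swap
  ...   | inj₂ refl        = x∈p∪q⁺ (inj₂ (x∈⁅x⁆ x′))
  ...   | inj₁ (w∈p , w≢a) = x∈p∪q⁺ (inj₁ (swap-kept (x∈p∧x≢y⇒x∈p-y w∈p w≢a) w≢b))

  swap-comm : ∀ (p : Subset n) a b x → swap (p - a) b x ≡ swap (p - b) a x
  swap-comm p a b x = cong (_∪ ⁅ x ⁆) (p─x─y≡p─y─x p a b)

toggle : ∀ {n} → Fin n → Subset n → Subset n
toggle x p = p [ x ]%= not

x∈toggle⇒x∉p : ∀ {n} {x : Fin n} p → x ∈ toggle x p → x ∉ p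
x∈toggle⇒x∉p {x = zero}  (inside ∷ p) ()        here
x∈toggle⇒x∉p {x = suc x} (_ ∷ p)      (there m) (there m′) = x∈toggle⇒x∉p p m m′

∈-toggle⁻ : ∀ {n} {w x : Fin n} p → w ≢ x → w ∈ toggle x p → w ∈ p
∈-toggle⁻ {w = zero}  {zero}  _       w≢x _         = ⊥-elim (w≢x refl)
∈-toggle⁻ {w = zero}  {suc x} (_ ∷ p) _   here      = here
∈-toggle⁻ {w = suc w} {zero}  (_ ∷ p) _   (there m) = there m
∈-toggle⁻ {w = suc w} {suc x} (_ ∷ p) w≢x (there m) = there (∈-toggle⁻ p (w≢x ∘ cong suc) m)

∈-toggle⁺ : ∀ {n} {w x : Fin n} {p} → w ≢ x → w ∈ p → w ∈ toggle x p
∈-toggle⁺ {w = w} {x} {p} = updateAt-minimal w x p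

toggle-comm : ∀ {n} (x y : Fin n) p → toggle x (toggle y p) ≡ toggle y (toggle x p)
toggle-comm x y p with x ≟ y
... | yes refl = refl
... | no x≢y   = updateAt-commutes x y x≢y p

infixl 6 _Δ_

_Δ_ : ∀ {n} → Subset n → List (Fin n) → Subset n
I Δ C = foldr toggle I C

Δ-resp-↭ : ∀ {n} (I : Subset n) {C C′} → C ↭ C′ → I Δ C ≡ I Δ C′
Δ-resp-↭ I ↭.refl         = refl
Δ-resp-↭ I (↭.prep x p)   = cong (toggle x) (Δ-resp-↭ I p)
Δ-resp-↭ I (↭.swap x y p) = trans (toggle-comm x y _) (cong (toggle y ∘ toggle x) (Δ-resp-↭ I p))
Δ-resp-↭ I (↭.trans p q)  = trans (Δ-resp-↭ I p) (Δ-resp-↭ I q)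

∈-Δ⁺ : ∀ {n} {I : Subset n} {C w} → w ∉ₗ C → w ∈ I → w ∈ I Δ C
∈-Δ⁺ {C = []}    _   w∈I = w∈I
∈-Δ⁺ {C = a ∷ C} w∉C w∈I = ∈-toggle⁺ (w∉C ∘ here) (∈-Δ⁺ (w∉C ∘ there) w∈I)

∈-Δ⁻ : ∀ {n} {I : Subset n} {C w} → Unique C → w ∈ I Δ C → (w ∈ I × w ∉ₗ C) ⊎ (w ∉ I × w ∈ₗ C)
∈-Δ⁻ {C = []} _ w∈ = inj₁ (w∈ , λ ())
∈-Δ⁻ {I = I} {a ∷ C} {w} u@(_ ∷ uC) w∈ with w ≟ a
... | yes refl = inj₂ (x∈toggle⇒x∉p (I Δ C) w∈ ∘ ∈-Δ⁺ (Unique[x∷xs]⇒x∉xs u) , here refl)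
... | no w≢a with ∈-Δ⁻ uC (∈-toggle⁻ (I Δ C) w≢a w∈)
...   | inj₁ (w∈I , w∉C) = inj₁ (w∈I , λ { (here w≡a) → w≢a w≡a ; (there w∈C) → w∉C w∈C })
...   | inj₂ (w∉I , w∈C) = inj₂ (w∉I , there w∈C)

Δ-≢ : ∀ {n} {I : Subset n} {v vs} → Unique (v ∷ vs) → v ∈ I → I Δ (v ∷ vs) ≢ I
Δ-≢ {v = v} uniq v∈I Δ≡I with ∈-Δ⁻ uniq (subst (v ∈_) (sym Δ≡I) v∈I)
... | inj₁ (_ , v∉C) = v∉C (here refl)
... | inj₂ (v∉I , _) = v∉I v∈I

-- Weights

module _ {n : ℕ} (V : Fin n → ℤ) where

  l-∈ : ∀ {p x} → x ∈ p → l V p x ≡ - V x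
  l-∈ {p} {x} x∈p with x ∈? p
  ... | yes _   = refl
  ... | no x∉p = ⊥-elim (x∉p x∈p)

  l-∉ : ∀ {p x} → x ∉ p → l V p x ≡ V x
  l-∉ {p} {x} x∉p with x ∈? p
  ... | yes x∈p = ⊥-elim (x∉p x∈p)
  ... | no _    = refl

  l-cong : ∀ {p q x} → (x ∈ p → x ∈ q) → (x ∈ q → x ∈ p) → l V p x ≡ l V q x
  l-cong {p} {q} {x} p⇒q q⇒p = byCases (x ∈? p)
    where
    byCases : Dec (x ∈ p) → l V p x ≡ l V q x
    byCases (yes x∈p) = trans (l-∈ x∈p) (sym (l-∈ (p⇒q x∈p)))
    byCases (no x∉p)  = trans (l-∉ x∉p) (sym (l-∉ (x∉p ∘ q⇒p)))

l-suc : ∀ {n} (V : Fin (suc n) → ℤ) b p x → l V (b ∷ p) (suc x) ≡ l (V ∘ suc) p x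
l-suc V b p x = byCases (x ∈? p)
  where
  byCases : Dec (x ∈ p) → l V (b ∷ p) (suc x) ≡ l (V ∘ suc) p x
  byCases (yes x∈p) = trans (l-∈ V (there x∈p)) (sym (l-∈ (V ∘ suc) x∈p))
  byCases (no x∉p)  = trans (l-∉ V (x∉p ∘ drop-there)) (sym (l-∉ (V ∘ suc) x∉p))

filter-∈?-suc : ∀ {n} b (p : Subset n) xs →
                filter (_∈? (b ∷ p)) (map suc xs) ≡ map suc (filter (_∈? p) xs)
filter-∈?-suc b p []       = refl
filter-∈?-suc b p (x ∷ xs) with x ∈? p
... | yes _ = cong (suc x ∷_) (filter-∈?-suc b p xs)
... | no _  = filter-∈?-suc b p xs

weightOf-tail : ∀ {n} (V : Fin (suc n) → ℤ) b p →
                sumℤ (map V (filter (_∈? (b ∷ p)) (tabulate suc))) ≡ weightOf (V ∘ suc) p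
weightOf-tail {n} V b p = begin
  sumℤ (map V (filter (_∈? (b ∷ p)) (tabulate suc)))
    ≡⟨ cong (sumℤ ∘ map V ∘ filter (_∈? (b ∷ p))) (sym (map-tabulate (λ i → i) suc)) ⟩
  sumℤ (map V (filter (_∈? (b ∷ p)) (map suc (allFin n))))
    ≡⟨ cong (sumℤ ∘ map V) (filter-∈?-suc b p (allFin n)) ⟩
  sumℤ (map V (map suc (filter (_∈? p) (allFin n))))
    ≡⟨ cong sumℤ (sym (map-∘ (filter (_∈? p) (allFin n)))) ⟩
  weightOf (V ∘ suc) p
    ∎
  where open ≡-Reasoning

weightOf-inside : ∀ {n} (V : Fin (suc n) → ℤ) p → weightOf V (inside ∷ p) ≡ V zero + weightOf (V ∘ suc) p
weightOf-inside V p = cong (λ w → V zero + w) (weightOf-tail V inside p)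

weightOf-outside : ∀ {n} (V : Fin (suc n) → ℤ) p → weightOf V (outside ∷ p) ≡ weightOf (V ∘ suc) p
weightOf-outside V p = weightOf-tail V outside p

weightOf-one : ∀ {n} (p : Subset n) → weightOf (λ _ → + 1) p ≡ + ∣ p ∣
weightOf-one []            = refl
weightOf-one (inside ∷ p)  =
  trans (weightOf-inside (λ _ → + 1) p) (cong (λ w → + 1 + w) (weightOf-one p))
weightOf-one (outside ∷ p) = trans (weightOf-outside (λ _ → + 1) p) (weightOf-one p)

weightOf-toggle : ∀ {n} (V : Fin n → ℤ) x p → weightOf V (toggle x p) ≡ weightOf V p + l V p x
weightOf-toggle V zero (inside ∷ p)
  rewrite weightOf-outside V p | weightOf-inside V p = cancel (V zero) (weightOf (V ∘ suc) p)
  where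
  cancel : ∀ v w → w ≡ v + w + - v
  cancel = solve-∀
weightOf-toggle V zero (outside ∷ p)
  rewrite weightOf-outside V p | weightOf-inside V p = ℤP.+-comm (V zero) (weightOf (V ∘ suc) p)
weightOf-toggle V (suc x) (inside ∷ p)
  rewrite weightOf-inside V (toggle x p) | weightOf-inside V p
        | weightOf-toggle (V ∘ suc) x p | l-suc V inside p x =
  sym (ℤP.+-assoc (V zero) (weightOf (V ∘ suc) p) (l (V ∘ suc) p x))
weightOf-toggle V (suc x) (outside ∷ p)
  rewrite weightOf-outside V (toggle x p) | weightOf-outside V p
        | weightOf-toggle (V ∘ suc) x p | l-suc V outside p x = refl

module _ {n : ℕ} (V : Fin n → ℤ) (I : Subset n) where

  private
    σ : List (Fin n) → ℤ
    σ = cycleWeight V I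

  weightOf-Δ : ∀ {C} → Unique C → weightOf V (I Δ C) ≡ weightOf V I + σ C
  weightOf-Δ {[]}    _ = sym (ℤP.+-identityʳ (weightOf V I))
  weightOf-Δ {a ∷ C} u@(_ ∷ uC) = begin
    weightOf V (toggle a (I Δ C))        ≡⟨ weightOf-toggle V a (I Δ C) ⟩
    weightOf V (I Δ C) + l V (I Δ C) a   ≡⟨ cong₂ _+_ (weightOf-Δ uC) (l-cong V a∈Δ⇒a∈I (∈-Δ⁺ a∉C)) ⟩
    weightOf V I + σ C + l V I a         ≡⟨ rearrange (weightOf V I) (σ C) (l V I a) ⟩
    weightOf V I + σ (a ∷ C)             ∎
    where
    open ≡-Reasoning
    a∉C : a ∉ₗ C
    a∉C = Unique[x∷xs]⇒x∉xs u
    a∈Δ⇒a∈I : a ∈ I Δ C → a ∈ I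
    a∈Δ⇒a∈I a∈ with ∈-Δ⁻ uC a∈
    ... | inj₁ (a∈I , _) = a∈I
    ... | inj₂ (_ , a∈C) = ⊥-elim (a∉C a∈C)
    rearrange : ∀ w s x → w + s + x ≡ w + (x + s)
    rearrange = solve-∀

  cycleWeight-++ : ∀ xs ys → σ (xs ++ ys) ≡ σ xs + σ ys
  cycleWeight-++ xs ys =
    trans (cong sumℤ (map-++ (l V I) xs ys)) (sumℤ-++ (map (l V I) xs) (map (l V I) ys))

  cycleWeight-resp-↭ : ∀ {C C′} → C ↭ C′ → σ C ≡ σ C′
  cycleWeight-resp-↭ p = sumℤ-resp-↭ (↭-map⁺ (l V I) p)

  cycleWeight-rotate-split : ∀ {K w u} P Q M T → K ≡ P ++ w ∷ Q → Q ++ P ≡ M ++ u ∷ T →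
                             σ K ≡ σ (w ∷ M ++ [ u ]) + σ T
  cycleWeight-rotate-split {w = w} {u} P Q M T refl QP≡ = begin
    σ (P ++ w ∷ Q)              ≡⟨ cycleWeight-resp-↭ (++-comm P (w ∷ Q)) ⟩
    σ (w ∷ Q ++ P)              ≡⟨ cong (σ ∘ (w ∷_)) (trans QP≡ (sym (++-assoc M [ u ] T))) ⟩
    σ ((w ∷ M ++ [ u ]) ++ T)   ≡⟨ cycleWeight-++ (w ∷ M ++ [ u ]) T ⟩
    σ (w ∷ M ++ [ u ]) + σ T    ∎
    where open ≡-Reasoning

  weightBefore : List (Fin n) → Fin n → ℤ
  weightBefore []      w = 0ℤ
  weightBefore (a ∷ K) w with w ≟ a
  ... | yes _ = 0ℤ
  ... | no _  = l V I a + weightBefore K w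

  weightBefore-++ : ∀ {w} X Y → w ∉ₗ X → weightBefore (X ++ w ∷ Y) w ≡ σ X
  weightBefore-++ {w} [] Y _ with w ≟ w
  ... | yes _   = refl
  ... | no w≢w = ⊥-elim (w≢w refl)
  weightBefore-++ {w} (a ∷ X) Y w∉ with w ≟ a
  ... | yes w≡a = ⊥-elim (w∉ (here w≡a))
  ... | no _    = cong (λ s → l V I a + s) (weightBefore-++ X Y (w∉ ∘ there))

  weightBefore-between : ∀ {K a b} X Y Z → Unique K → K ≡ X ++ a ∷ Y ++ b ∷ Z →
                         weightBefore K b ≡ weightBefore K a + σ (a ∷ Y)
  weightBefore-between {a = a} {b} X Y Z u refl = begin
    weightBefore K b                ≡⟨ cong (λ L → weightBefore L b) K≡ ⟩
    weightBefore (XaY ++ b ∷ Z) b   ≡⟨ weightBefore-++ XaY Z (Unique⇒∉-prefix XaY (subst Unique K≡ u)) ⟩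
    σ (X ++ a ∷ Y)                  ≡⟨ cycleWeight-++ X (a ∷ Y) ⟩
    σ X + σ (a ∷ Y)                 ≡⟨ cong (_+ σ (a ∷ Y)) (weightBefore-++ X (Y ++ b ∷ Z) a∉X) ⟨
    weightBefore K a + σ (a ∷ Y)    ∎
    where
    open ≡-Reasoning
    K = X ++ a ∷ Y ++ b ∷ Z
    XaY = X ++ a ∷ Y
    K≡ : K ≡ XaY ++ b ∷ Z
    K≡ = sym (++-assoc X (a ∷ Y) (b ∷ Z))
    a∉X : a ∉ₗ X
    a∉X = Unique⇒∉-prefix X u

cycleWeight-one-unpairs : ∀ {n} {I : Subset n} ps → All (λ p → proj₁ p ∈ I × proj₂ p ∉ I) ps →
                          cycleWeight (λ _ → + 1) I (unpairs ps) ≡ 0ℤ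
cycleWeight-one-unpairs []             []                   = refl
cycleWeight-one-unpairs ((y , x) ∷ ps) ((y∈I , x∉I) ∷ rest) =
  cong₂ _+_ (l-∈ _ y∈I) (cong₂ _+_ (l-∉ _ x∉I) (cycleWeight-one-unpairs ps rest))

-- Exchanging several pairs in one matroid

WithinExchange : ∀ {n} → Subset n → List (Fin n × Fin n) → Subset n → Set
WithinExchange I ps J =
  ∀ {w} → w ∈ J → (w ∈ I × All (λ p → w ≢ proj₁ p) ps) ⊎ Any (λ p → w ≡ proj₂ p) ps

module _ {n : ℕ} (M : Matroid n) where

  Exchangeable : Subset n → Fin n × Fin n → Set
  Exchangeable I p = proj₁ p ∈ I × proj₂ p ∉ I × Indep M (swap I (proj₁ p) (proj₂ p))

  Blocked : Subset n → Fin n × Fin n → Fin n × Fin n → Set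
  Blocked I p q = ¬ Indep M (swap I (proj₁ p) (proj₂ q))

  Indep-swap-swap : ∀ {I y₀ x₀ y x} → y₀ ∈ I → y ∈ I → y ≢ y₀ → x₀ ∉ I → x ∉ I →
                    Indep M (swap I y₀ x₀) → Indep M (swap I y x) → ¬ Indep M (swap I y₀ x) →
                    Indep M (swap (swap I y₀ x₀) y x)
  Indep-swap-swap {I} {y₀} {x₀} {y} {x} y₀∈I y∈I y≢y₀ x₀∉I x∉I ind₀ ind dep =
    conclude (augment M indA ind₀ ∣A∣<∣B∣)
    where
    A = swap (I - y₀) y x
    indA : Indep M A
    indA = hereditary M (swap-mono (p─q⊆p I ⁅ y₀ ⁆)) ind
    ∣A∣<∣B∣ : ∣ A ∣ ℕ.< ∣ swap I y₀ x₀ ∣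
    ∣A∣<∣B∣ = begin-strict
      ∣ A ∣            ≤⟨ ∣swap∣≤∣p∣ (x∈p∧x≢y⇒x∈p-y y∈I y≢y₀) (x∉I ∘ p─q⊆p I ⁅ y₀ ⁆) ⟩
      ∣ I - y₀ ∣       <⟨ ℕP.n<1+n _ ⟩
      suc ∣ I - y₀ ∣   ≡⟨ x∉p⇒∣p∪⁅x⁆∣≡1+∣p∣ (I - y₀) (x₀∉I ∘ p─q⊆p I ⁅ y₀ ⁆) ⟨
      ∣ swap I y₀ x₀ ∣ ∎
      where open ℕP.≤-Reasoning
    conclude : (∃ λ z → z ∈ swap I y₀ x₀ × z ∉ A × Indep M (A ∪ ⁅ z ⁆)) →
               Indep M (swap (swap I y₀ x₀) y x)
    conclude (z , z∈B , z∉A , indA+z) with ∈-swap⁻ z∈B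
    ... | inj₂ refl = hereditary M swap²⊆swap-∪⁅⁆ indA+z
    ... | inj₁ (z∈I , z≢y₀) with z ≟ y
    ...   | yes refl = ⊥-elim (dep (hereditary M (swap⊆swap-∪⁅⁆ y) indA+z))
    ...   | no z≢y   = ⊥-elim (z∉A (swap-kept (x∈p∧x≢y⇒x∈p-y z∈I z≢y₀) z≢y))

  Indep-swap-swap⁻ : ∀ {I y₀ x₀ y x} → Indep M I → y₀ ∈ I → y ∈ I → y ≢ y₀ → x ∉ I →
                     Indep M (swap (swap I y₀ x₀) y x) →
                     Indep M (swap I y x) ⊎ Indep M (swap I y₀ x)
  Indep-swap-swap⁻ {I} {y₀} {x₀} {y} {x} indI y₀∈I y∈I y≢y₀ x∉I ind =
    conclude (augment M indA indI ∣A∣<∣I∣)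
    where
    A = swap (I - y₀) y x
    indA : Indep M A
    indA = hereditary M (swap-mono (p⊆p∪q ⁅ x₀ ⁆)) ind
    ∣A∣<∣I∣ : ∣ A ∣ ℕ.< ∣ I ∣
    ∣A∣<∣I∣ = ℕP.≤-<-trans (∣swap∣≤∣p∣ (x∈p∧x≢y⇒x∈p-y y∈I y≢y₀) (x∉I ∘ p─q⊆p I ⁅ y₀ ⁆))
                           (x∈p⇒∣p-x∣<∣p∣ y₀∈I)
    conclude : (∃ λ z → z ∈ I × z ∉ A × Indep M (A ∪ ⁅ z ⁆)) →
               Indep M (swap I y x) ⊎ Indep M (swap I y₀ x)
    conclude (z , z∈I , z∉A , indA+z) with z ≟ y₀
    ... | yes refl = inj₁ (hereditary M (subst (λ S → swap I y x ⊆ S ∪ ⁅ z ⁆) (swap-comm I y z x)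
                                               (swap⊆swap-∪⁅⁆ z)) indA+z)
    ... | no z≢y₀ with z ≟ y
    ...   | yes refl = inj₂ (hereditary M (swap⊆swap-∪⁅⁆ z) indA+z)
    ...   | no z≢y   = ⊥-elim (z∉A (swap-kept (x∈p∧x≢y⇒x∈p-y z∈I z≢y₀) z≢y))

  -- Performing the first exchange keeps the remaining pairs exchangeable (Indep-swap-swap)
  -- and blocked (Indep-swap-swap⁻).
  ordered-exchange-independent : ∀ {I J} ps → Indep M I → All (Exchangeable I) ps →
                                 AllPairs (Blocked I) ps → WithinExchange I ps J → Indep M J
  ordered-exchange-independent {I} {J} [] indI _ _ J⊆ = hereditary M J⊆I indI
    where
    J⊆I : J ⊆ I
    J⊆I w∈J with J⊆ w∈J
    ... | inj₁ (w∈I , _) = w∈I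
  ordered-exchange-independent {I} {J} ((y₀ , x₀) ∷ ps) indI ((y₀∈I , x₀∉I , ind₀) ∷ exs)
                               (blocked₀ ∷ blocked) J⊆ =
    ordered-exchange-independent ps ind₀ (All.map exchangeable₁ exs₀) blocked₁ J⊆I₁
    where
    I₁ = swap I y₀ x₀
    exs₀ : All (λ q → Exchangeable I q × Blocked I (y₀ , x₀) q) ps
    exs₀ = All.zip (exs , blocked₀)
    y≢y₀ : ∀ {q} → Exchangeable I q × Blocked I (y₀ , x₀) q → proj₁ q ≢ y₀
    y≢y₀ ((_ , _ , ind) , dep₀) refl = dep₀ ind
    exchangeable₁ : ∀ {q} → Exchangeable I q × Blocked I (y₀ , x₀) q → Exchangeable I₁ q
    exchangeable₁ q@((y∈I , x∉I , ind) , dep₀) =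
      swap-kept y∈I (y≢y₀ q) ,
      [ x∉I ∘ proj₁ , (λ { refl → dep₀ ind₀ }) ]′ ∘ ∈-swap⁻ ,
      Indep-swap-swap y₀∈I y∈I (y≢y₀ q) x₀∉I x∉I ind₀ ind dep₀
    blocked₁ : AllPairs (Blocked I₁) ps
    blocked₁ = AllPairs-mapWith
      (λ q@((y∈I , _) , _) ((_ , x′∉I , _) , dep₀′) dep ind₁ →
         [ dep , dep₀′ ]′ (Indep-swap-swap⁻ indI y₀∈I y∈I (y≢y₀ q) x′∉I ind₁))
      exs₀ blocked
    x₀≢ys : All (λ q → x₀ ≢ proj₁ q) ps
    x₀≢ys = All.map (λ (y∈I , _) x₀≡y → x₀∉I (subst (_∈ I) (sym x₀≡y) y∈I)) exs
    J⊆I₁ : WithinExchange I₁ ps J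
    J⊆I₁ w∈J with J⊆ w∈J
    ... | inj₁ (w∈I , w≢y₀ ∷ w≢ys) = inj₁ (swap-kept w∈I w≢y₀ , w≢ys)
    ... | inj₂ (here refl)         = inj₁ (swap-new , x₀≢ys)
    ... | inj₂ (there w∈xs)        = inj₂ w∈xs

  -- Sorted by G, the pairs admit no exchange of a y against the x of a later pair.
  potential-exchange-independent : ∀ {I J} (G : Fin n × Fin n → ℤ) ps → Indep M I →
    All (Exchangeable I) ps → AllPairs (_≢_ on proj₂) ps →
    (∀ {p q} → p ∈ₗ ps → q ∈ₗ ps → proj₂ p ≢ proj₂ q →
               Indep M (swap I (proj₁ p) (proj₂ q)) → G q ℤ.< G p) →
    WithinExchange I ps J → Indep M J
  potential-exchange-independent {I} {J} G ps indI exs distinct descends J⊆ =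
    ordered-exchange-independent qs indI (All-resp-↭ ps↭qs exs) blocked J⊆′
    where
    qs = sortBy G ps
    ps↭qs : ps ↭ qs
    ps↭qs = ↭-sym (sortBy-↭ G ps)
    qs⊆ps : All (_∈ₗ ps) qs
    qs⊆ps = All.tabulate (∈-resp-↭ (sortBy-↭ G ps))
    distinct′ : AllPairs (_≢_ on proj₂) qs
    distinct′ = AllPairsₚ.map⁻ (Unique-resp-↭ (↭-map⁺ proj₂ ps↭qs) (AllPairsₚ.map⁺ distinct))
    blocked : AllPairs (Blocked I) qs
    blocked = AllPairs-mapWith (λ p∈ q∈ (x≢x′ , Gp≤Gq) ind → ℤP.≤⇒≯ Gp≤Gq (descends p∈ q∈ x≢x′ ind))
                               qs⊆ps (AllPairs.zip (distinct′ , sortBy-sorted G ps))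
    J⊆′ : WithinExchange I qs J
    J⊆′ w∈J with J⊆ w∈J
    ... | inj₁ (w∈I , w≢ys) = inj₁ (w∈I , All-resp-↭ ps↭qs w≢ys)
    ... | inj₂ w∈xs         = inj₂ (Any-resp-↭ ps↭qs w∈xs)

-- The exchange graph

module _ {n : ℕ} (M₁ M₂ : Matroid n) (I : Subset n) where

  edge-from-∈ : ∀ {a b} → Edge M₁ M₂ I a b → a ∈ I → b ∉ I × Indep M₁ (swap I a b)
  edge-from-∈ (edge₁ x∉I _ ind) _   = x∉I , ind
  edge-from-∈ (edge₂ x∉I _ _)   a∈I = ⊥-elim (x∉I a∈I)

  edge-from-∉ : ∀ {a b} → Edge M₁ M₂ I a b → a ∉ I → b ∈ I
  edge-from-∉ (edge₁ _ y∈I _) a∉I = ⊥-elim (a∉I y∈I)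
  edge-from-∉ (edge₂ _ y∈I _) _   = y∈I

  Edge-irrefl : ∀ {a} → ¬ Edge M₁ M₂ I a a
  Edge-irrefl (edge₁ x∉I y∈I _) = x∉I y∈I
  Edge-irrefl (edge₂ x∉I y∈I _) = x∉I y∈I

  Edge-flip : ∀ {a b} → Edge M₁ M₂ I a b → Edge M₂ M₁ I b a
  Edge-flip (edge₁ x∉I y∈I ind) = edge₂ x∉I y∈I ind
  Edge-flip (edge₂ x∉I y∈I ind) = edge₁ x∉I y∈I ind

  Chain-++⁻ : ∀ {a b d} cs ds → Chain M₁ M₂ I a (cs ++ d ∷ ds) b →
              Chain M₁ M₂ I a cs d × Chain M₁ M₂ I d ds b
  Chain-++⁻ []       ds (e , ch) = e , ch
  Chain-++⁻ (c ∷ cs) ds (e , ch) = map₁ (e ,_) (Chain-++⁻ cs ds ch)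

  Chain-++⁺ : ∀ {a b d} cs ds → Chain M₁ M₂ I a cs d → Chain M₁ M₂ I d ds b →
              Chain M₁ M₂ I a (cs ++ d ∷ ds) b
  Chain-++⁺ []       ds e        ch′ = e , ch′
  Chain-++⁺ (c ∷ cs) ds (e , ch) ch′ = e , Chain-++⁺ cs ds ch ch′

  chain-pairs : ∀ {a b} cs → Chain M₁ M₂ I a cs b → a ∈ I → b ∈ I →
                ∃ λ ps → unpairs ps ≡ a ∷ cs × All (Exchangeable M₁ I) ps
  chain-pairs []               e             a∈I b∈I = ⊥-elim (proj₁ (edge-from-∈ e a∈I) b∈I)
  chain-pairs {a} (c ∷ [])     (e , _)       a∈I _   =
    [ (a , c) ] , refl , (a∈I , edge-from-∈ e a∈I) ∷ []
  chain-pairs {a} (c ∷ d ∷ cs) (e , e′ , ch) a∈I b∈I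
    with chain-pairs cs ch (edge-from-∉ e′ (proj₁ (edge-from-∈ e a∈I))) b∈I
  ... | ps , unpairs≡ , exs =
    (a , c) ∷ ps , cong (λ L → a ∷ c ∷ L) unpairs≡ , (a∈I , edge-from-∈ e a∈I) ∷ exs

  IsCycle⇒Unique : ∀ {C} → IsCycle M₁ M₂ I C → Unique C
  IsCycle⇒Unique {_ ∷ _} (u , _) = u

  IsCycle-rotate : ∀ R w T → IsCycle M₁ M₂ I (R ++ w ∷ T) → IsCycle M₁ M₂ I (w ∷ T ++ R)
  IsCycle-rotate []      w T cyc = subst (λ K → IsCycle M₁ M₂ I (w ∷ K)) (sym (++-identityʳ T)) cyc
  IsCycle-rotate (r ∷ R) w T (u , ch) =
    Unique-resp-↭ (++-comm (r ∷ R) (w ∷ T)) u ,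
    (let ch₁ , ch₂ = Chain-++⁻ R T ch in Chain-++⁺ T R ch₂ ch₁)

  IsCycle-startingIn : ∀ {C} → IsCycle M₁ M₂ I C →
                       ∃₂ λ v vs → v ∷ vs ↭ C × IsCycle M₁ M₂ I (v ∷ vs) × v ∈ I
  IsCycle-startingIn {v ∷ vs} cyc with v ∈? I
  ... | yes v∈I = v , vs , ↭.refl , cyc , v∈I
  IsCycle-startingIn {v ∷ []}     (_ , e)         | no _    = ⊥-elim (Edge-irrefl e)
  IsCycle-startingIn {v ∷ w ∷ vs} cyc@(_ , e , _) | no v∉I =
    w , vs ++ [ v ] , ++-comm (w ∷ vs) [ v ] , IsCycle-rotate [ v ] w vs cyc , edge-from-∉ e v∉I

  IsCycle-shortcut : ∀ {w u} M T → IsCycle M₁ M₂ I (w ∷ M ++ u ∷ T) → Edge M₁ M₂ I u w →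
                     IsCycle M₁ M₂ I (w ∷ M ++ [ u ])
  IsCycle-shortcut {w} {u} M T (uniq , ch) e =
    Unique-++⁻ˡ (w ∷ M ++ [ u ]) (subst Unique (cong (w ∷_) (sym (++-assoc M [ u ] T))) uniq) ,
    Chain-++⁺ M [] (proj₁ (Chain-++⁻ M T ch)) e

  ∣Δ∣≡∣I∣ : ∀ {v vs} → IsCycle M₁ M₂ I (v ∷ vs) → v ∈ I → ∣ I Δ (v ∷ vs) ∣ ≡ ∣ I ∣
  ∣Δ∣≡∣I∣ {v} {vs} (uniq , ch) v∈I with chain-pairs vs ch v∈I v∈I
  ... | ps , unpairs≡ , exs = ℤP.+-injective (begin
    + ∣ I Δ K ∣                       ≡⟨ weightOf-one (I Δ K) ⟨
    weightOf 𝟙 (I Δ K)                ≡⟨ weightOf-Δ 𝟙 I uniq ⟩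
    weightOf 𝟙 I + cycleWeight 𝟙 I K  ≡⟨ cong (λ s → weightOf 𝟙 I + s) balanced ⟩
    weightOf 𝟙 I + 0ℤ                 ≡⟨ ℤP.+-identityʳ _ ⟩
    weightOf 𝟙 I                      ≡⟨ weightOf-one I ⟩
    + ∣ I ∣                           ∎)
    where
    open ≡-Reasoning
    K = v ∷ vs
    𝟙 : Fin n → ℤ
    𝟙 _ = + 1
    balanced : cycleWeight 𝟙 I K ≡ 0ℤ
    balanced = subst (λ L → cycleWeight 𝟙 I L ≡ 0ℤ) unpairs≡
                 (cycleWeight-one-unpairs ps (All.map (λ (y∈I , x∉I , _) → y∈I , x∉I) exs))

Chain-reverse : ∀ {n} (M₁ M₂ : Matroid n) I {a b} cs →
                Chain M₁ M₂ I a cs b → Chain M₂ M₁ I b (reverse cs) a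
Chain-reverse M₁ M₂ I []       e        = Edge-flip M₁ M₂ I e
Chain-reverse M₁ M₂ I {a} {b} (c ∷ cs) (e , ch) =
  subst (λ ds → Chain M₂ M₁ I b ds a) (sym (unfold-reverse c cs))
        (Chain-++⁺ M₂ M₁ I (reverse cs) [] (Chain-reverse M₁ M₂ I cs ch) (Edge-flip M₁ M₂ I e))

IsCycle-reverse : ∀ {n} (M₁ M₂ : Matroid n) I {v vs} →
                  IsCycle M₁ M₂ I (v ∷ vs) → IsCycle M₂ M₁ I (v ∷ reverse vs)
IsCycle-reverse M₁ M₂ I {v} {vs} (u , ch) =
  Unique-resp-↭ (↭-prep v (↭-sym (↭-reverse vs))) u , Chain-reverse M₁ M₂ I vs ch

-- Shortest nonpositive cycles

CyclesPositiveBelow : ∀ {n} → Matroid n → Matroid n → (Fin n → ℤ) → Subset n → ℕ → Set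
CyclesPositiveBelow M₁ M₂ W I m =
  ∀ C → length C ℕ.< m → IsCycle M₁ M₂ I C → 0ℤ ℤ.< cycleWeight W I C

CyclesPositiveBelow-flip : ∀ {n} {M₁ M₂ : Matroid n} {W I m} →
                           CyclesPositiveBelow M₁ M₂ W I m → CyclesPositiveBelow M₂ M₁ W I m
CyclesPositiveBelow-flip {M₁ = M₁} {M₂} {W} {I} {m} pos (v ∷ vs) len cyc =
  subst (0ℤ ℤ.<_) (cycleWeight-resp-↭ W I reversed↭)
    (pos (v ∷ reverse vs) (subst (ℕ._< m) (sym (↭-length reversed↭)) len)
         (IsCycle-reverse M₂ M₁ I cyc))
  where
  reversed↭ : v ∷ reverse vs ↭ v ∷ vs
  reversed↭ = ↭-prep v (↭-reverse vs)

module _ {n : ℕ} (M₁ M₂ : Matroid n) (W : Fin n → ℤ) (I : Subset n) where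

  private
    σ : List (Fin n) → ℤ
    σ = cycleWeight W I

  shortcut-positive : ∀ {K w u t} P Q M T → CyclesPositiveBelow M₁ M₂ W I (length K) →
                      IsCycle M₁ M₂ I K → K ≡ P ++ w ∷ Q → Q ++ P ≡ M ++ u ∷ t ∷ T → Edge M₁ M₂ I u w →
                      0ℤ ℤ.< σ (w ∷ M ++ [ u ])
  shortcut-positive {K} {w} P Q M T pos cyc refl QP≡ e =
    pos (w ∷ M ++ _) (ℕP.<-≤-trans (s≤s (length-++-∷ʳ< M)) (ℕP.≤-reflexive len≡))
        (IsCycle-shortcut M₁ M₂ I M _ rotated e)
    where
    rotated : IsCycle M₁ M₂ I (w ∷ M ++ _ ∷ _ ∷ T)
    rotated = subst (λ L → IsCycle M₁ M₂ I (w ∷ L)) QP≡ (IsCycle-rotate M₁ M₂ I P w Q cyc)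
    len≡ : length (w ∷ M ++ _ ∷ _ ∷ T) ≡ length K
    len≡ = trans (cong (suc ∘ length) (sym QP≡)) (↭-length (++-comm (w ∷ Q) P))

  -- The chord u → w closes the shorter cycle w … u. If w precedes u, its weight is exactly the
  -- gap between the two potentials; otherwise it is σ K minus the arc u′ … w, which is
  -- therefore negative as σ K ≤ 0.
  shortcut-descends : ∀ {K R N u u′ w} → IsCycle M₁ M₂ I K → σ K ℤ.≤ 0ℤ →
                      CyclesPositiveBelow M₁ M₂ W I (length K) →
                      K ≡ R ++ u ∷ u′ ∷ N → Edge M₁ M₂ I u w → w ∈ₗ K → w ≢ u′ →
                      weightBefore W I K w ℤ.< weightBefore W I K u′
  shortcut-descends {K} {R} {N} {u} {u′} {w} cyc σK≤0 pos refl e w∈K w≢u′ with ∈-++⁻ R w∈K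
  ... | inj₂ (here refl)         = ⊥-elim (Edge-irrefl M₁ M₂ I e)
  ... | inj₂ (there (here refl)) = ⊥-elim (w≢u′ refl)
  ... | inj₁ w∈R with ∈-∃++ w∈R
  ...   | R₁ , R₂ , refl = begin-strict
    weightBefore W I K w                        <⟨ i<i+j shortcut>0 ⟩
    weightBefore W I K w + σ (w ∷ R₂ ++ [ u ])  ≡⟨ weightBefore-between W I R₁ (R₂ ++ [ u ]) N uniq K≡ ⟨
    weightBefore W I K u′                       ∎
    where
    open ℤP.≤-Reasoning
    uniq = IsCycle⇒Unique M₁ M₂ I cyc
    shortcut>0 : 0ℤ ℤ.< σ (w ∷ R₂ ++ [ u ])
    shortcut>0 = shortcut-positive R₁ (R₂ ++ u ∷ u′ ∷ N) R₂ (N ++ R₁) pos cyc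
                   (++-assoc R₁ (w ∷ R₂) (u ∷ u′ ∷ N)) (++-assoc R₂ (u ∷ u′ ∷ N) R₁) e
    K≡ : K ≡ R₁ ++ w ∷ (R₂ ++ [ u ]) ++ u′ ∷ N
    K≡ = trans (++-assoc R₁ (w ∷ R₂) (u ∷ u′ ∷ N))
               (cong (λ L → R₁ ++ w ∷ L) (sym (++-assoc R₂ [ u ] (u′ ∷ N))))
  shortcut-descends {K} {R} {N} {u} {u′} {w} cyc σK≤0 pos refl e w∈K w≢u′
    | inj₂ (there (there w∈N)) with ∈-∃++ w∈N
  ...   | N₁ , N₂ , refl = begin-strict
    weightBefore W I K w                  ≡⟨ weightBefore-between W I (R ++ [ u ]) N₁ N₂ uniq K≡′ ⟩
    weightBefore W I K u′ + σ (u′ ∷ N₁)   <⟨ i+j<i (0<i∧i+j≤0⇒j<0 shortcut>0 σS+σN≤0) ⟩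
    weightBefore W I K u′                 ∎
    where
    open ℤP.≤-Reasoning
    uniq = IsCycle⇒Unique M₁ M₂ I cyc
    P = R ++ u ∷ u′ ∷ N₁
    K≡ : K ≡ P ++ w ∷ N₂
    K≡ = sym (++-assoc R (u ∷ u′ ∷ N₁) (w ∷ N₂))
    K≡′ : K ≡ (R ++ [ u ]) ++ u′ ∷ N₁ ++ w ∷ N₂
    K≡′ = sym (++-assoc R [ u ] (u′ ∷ N₁ ++ w ∷ N₂))
    N₂P≡ : N₂ ++ P ≡ (N₂ ++ R) ++ u ∷ u′ ∷ N₁
    N₂P≡ = sym (++-assoc N₂ R (u ∷ u′ ∷ N₁))
    shortcut>0 : 0ℤ ℤ.< σ (w ∷ (N₂ ++ R) ++ [ u ])
    shortcut>0 = shortcut-positive P N₂ (N₂ ++ R) N₁ pos cyc K≡ N₂P≡ e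
    σS+σN≤0 : σ (w ∷ (N₂ ++ R) ++ [ u ]) + σ (u′ ∷ N₁) ℤ.≤ 0ℤ
    σS+σN≤0 = subst (ℤ._≤ 0ℤ) (cycleWeight-rotate-split W I P N₂ (N₂ ++ R) (u′ ∷ N₁) K≡ N₂P≡) σK≤0

  Δ-independent₁ : ∀ {v vs} → Indep M₁ I → IsCycle M₁ M₂ I (v ∷ vs) → v ∈ I → σ (v ∷ vs) ℤ.≤ 0ℤ →
                   CyclesPositiveBelow M₁ M₂ W I (length (v ∷ vs)) → Indep M₁ (I Δ (v ∷ vs))
  Δ-independent₁ {v} {vs} indI cyc@(uniq , ch) v∈I σ≤0 pos with chain-pairs M₁ M₂ I vs ch v∈I v∈I
  ... | ps , unpairs≡ , exs =
    potential-exchange-independent M₁ (weightBefore W I K ∘ proj₂) ps indI exs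
      (unpairs-proj₂-distinct (subst Unique (sym unpairs≡) uniq)) descends within
    where
    K = v ∷ vs
    ∈K : ∀ {w} → w ∈ₗ unpairs ps → w ∈ₗ K
    ∈K = subst (_ ∈ₗ_) unpairs≡
    descends : ∀ {p q} → p ∈ₗ ps → q ∈ₗ ps → proj₂ p ≢ proj₂ q → Indep M₁ (swap I (proj₁ p) (proj₂ q)) →
               weightBefore W I K (proj₂ q) ℤ.< weightBefore W I K (proj₂ p)
    descends p∈ q∈ x≢x′ ind with unpairs-split p∈
    ... | R , N , split =
      shortcut-descends cyc σ≤0 pos (trans (sym unpairs≡) split)
        (edge₁ (proj₁ (proj₂ (All.lookup exs q∈))) (proj₁ (All.lookup exs p∈)) ind)
        (∈K (proj₂ (∈-unpairs q∈))) (x≢x′ ∘ sym)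
    within : WithinExchange I ps (I Δ K)
    within w∈ with ∈-Δ⁻ uniq w∈
    ... | inj₁ (w∈I , w∉K) =
      inj₁ (w∈I , All.tabulate (λ p∈ w≡y → w∉K (∈K (subst (_∈ₗ _) (sym w≡y) (proj₁ (∈-unpairs p∈))))))
    ... | inj₂ (w∉I , w∈K) =
      inj₂ (unpairs-cover (All.map proj₁ exs) (subst (_ ∈ₗ_) (sym unpairs≡) w∈K) w∉I)

-- Reversing the cycle turns its M₂-exchanges into the M₁-exchanges of the flipped graph.
Δ-commonIndep : ∀ {n} {M₁ M₂ : Matroid n} {W I v vs} → CommonIndep M₁ M₂ I →
                IsCycle M₁ M₂ I (v ∷ vs) → v ∈ I → cycleWeight W I (v ∷ vs) ℤ.≤ 0ℤ →
                CyclesPositiveBelow M₁ M₂ W I (length (v ∷ vs)) → CommonIndep M₁ M₂ (I Δ (v ∷ vs))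
Δ-commonIndep {M₁ = M₁} {M₂} {W} {I} {v} {vs} (ind₁ , ind₂) cyc v∈I σ≤0 pos =
  Δ-independent₁ M₁ M₂ W I ind₁ cyc v∈I σ≤0 pos ,
  subst (Indep M₂) (Δ-resp-↭ I reversed↭)
    (Δ-independent₁ M₂ M₁ W I ind₂ (IsCycle-reverse M₁ M₂ I cyc) v∈I
      (subst (ℤ._≤ 0ℤ) (sym (cycleWeight-resp-↭ W I reversed↭)) σ≤0)
      (subst (CyclesPositiveBelow M₂ M₁ W I) (sym (↭-length reversed↭)) (CyclesPositiveBelow-flip pos)))
  where
  reversed↭ : v ∷ reverse vs ↭ v ∷ vs
  reversed↭ = ↭-prep v (↭-reverse vs)

module _ {n : ℕ} {M₁ M₂ : Matroid n} {W : Fin n → ℤ} {k : ℕ} {I : Subset n}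
         (isolating : Isolates M₁ M₂ W k I) where

  minimal-cycle-positive : ∀ {C} → CyclesPositiveBelow M₁ M₂ W I (length C) → IsCycle M₁ M₂ I C →
                           0ℤ ℤ.< cycleWeight W I C
  minimal-cycle-positive pos cyc with IsCycle-startingIn M₁ M₂ I cyc
  ... | v , vs , K↭C , cycK , v∈I =
    ℤP.≰⇒> (nonpositive⇒⊥ ∘ subst (ℤ._≤ 0ℤ) (sym (cycleWeight-resp-↭ W I K↭C)))
    where
    open ℤP.≤-Reasoning
    K = v ∷ vs
    J = I Δ K
    uniq = IsCycle⇒Unique M₁ M₂ I cycK
    ∣J∣≡k : ∣ J ∣ ≡ k
    ∣J∣≡k = trans (∣Δ∣≡∣I∣ M₁ M₂ I cycK v∈I) (proj₁ (proj₂ isolating))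
    nonpositive⇒⊥ : ¬ cycleWeight W I K ℤ.≤ 0ℤ
    nonpositive⇒⊥ σK≤0 = ℤP.<-irrefl refl (begin-strict
      weightOf W I                      <⟨ proj₂ (proj₂ isolating) J commonJ ∣J∣≡k (Δ-≢ uniq v∈I) ⟩
      weightOf W J                      ≡⟨ weightOf-Δ W I uniq ⟩
      weightOf W I + cycleWeight W I K  ≤⟨ ℤP.+-monoʳ-≤ (weightOf W I) σK≤0 ⟩
      weightOf W I + 0ℤ                 ≡⟨ ℤP.+-identityʳ _ ⟩
      weightOf W I                      ∎)
      where
      commonJ : CommonIndep M₁ M₂ J
      commonJ = Δ-commonIndep (proj₁ isolating) cycK v∈I σK≤0
                  (subst (CyclesPositiveBelow M₁ M₂ W I) (sym (↭-length K↭C)) pos)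

  cycleWeight-positive : ∀ C → IsCycle M₁ M₂ I C → 0ℤ ℤ.< cycleWeight W I C
  cycleWeight-positive C = positiveBelow (suc (length C)) C ℕP.≤-refl
    where
    positiveBelow : ∀ m → CyclesPositiveBelow M₁ M₂ W I m
    positiveBelow (suc m) C (s≤s len≤m) =
      minimal-cycle-positive (λ C′ len′ → positiveBelow m C′ (ℕP.<-≤-trans len′ len≤m))

lemma5p2 : ∀ {n} (M₁ M₂ : Matroid n) (W : Fin n → ℤ) (k : ℕ) (Iₖ : Subset n) →
    Isolates M₁ M₂ W k Iₖ →
    ∀ (C : List (Fin n)) → IsCycle M₁ M₂ Iₖ C → cycleWeight W Iₖ C ≢ 0ℤ
lemma5p2 M₁ M₂ W k Iₖ isolating C cyc σ≡0 = ℤP.<-irrefl (sym σ≡0) (cycleWeight-positive isolating C cyc)
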